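{- Let $G$ be an $(S_{1,2,5},S_{3,3,3})$-free chordal bipartite graph and let $D$ be an efficient dominating set of $G$ such that no vertex of $D$ is the midpoint (middle vertex) of an induced path $P_5$ in $G$. Then for every induced path $P_8$ $P=(u_1,v_1,u_2,v_2,u_3,v_3,u_4,v_4)$ in $G$, $D\cap V(P)=\{v_1,u_4\}$.
   Context: All graphs are finite, simple and undirected. A set $D\subseteq V(G)$ is an efficient dominating set of $G$ if $|D\cap N[w]|=1$ for every vertex $w$, where $N[w]$ is the closed neighbourhood of $w$. For $i,j,k\ge0$, $S_{i,j,k}$ is the tree formed by a center $u$ and three induced paths from $u$ with $i$, $j$, $k$ further vertices respectively, pairwise sharing only $u$. A bipartite graph is chordal bipartite if it has no induced cycle $C_{2k}$ with $k\ge3$. -}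

module Defs where

open import Data.Nat using (ℕ; zero; suc; _≡ᵇ_; _≤_; _*_; s≤s; z≤n)
open import Data.Fin using (Fin; toℕ; fromℕ<)
open import Data.Bool using (Bool; true; false; _∧_; _∨_)
open import Data.List using (List; []; _∷_)
open import Data.Bool.ListAction using (any)
open import Data.Product using (Σ; _×_; _,_; ∃; ∃-syntax)
open import Data.Sum using (_⊎_)
open import Relation.Binary.PropositionalEquality using (_≡_; _≢_)
open import Relation.Nullary using (¬_)
open import Function.Definitions using (Injective)

record Graph : Set where
  field
    n      : ℕ
    adj    : Fin n → Fin n → Bool
    sym    : ∀ x y → adj x y ≡ adj y x
    irrefl : ∀ x → adj x x ≡ false
open Graph public

V : Graph → Set
V G = Fin (n G)

Pattern : ℕ → Set
Pattern k = Fin k → Fin k → Bool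

InducedCopy : ∀ {k} → Pattern k → (G : Graph) → (Fin k → V G) → Set
InducedCopy H G f = Injective _≡_ _≡_ f × (∀ i j → H i j ≡ adj G (f i) (f j))

HasInduced : ∀ {k} → Pattern k → Graph → Set
HasInduced H G = ∃[ f ] InducedCopy H G f

Free : ∀ {k} → Pattern k → Graph → Set
Free H G = ¬ HasInduced H G

pathP : (k : ℕ) → Pattern k
pathP k i j = (suc (toℕ i) ≡ᵇ toℕ j) ∨ (suc (toℕ j) ≡ᵇ toℕ i)

-- Cycle C_m on vertices 0,...,m-1 (meaningful for m ≥ 3).
cycleC : (m : ℕ) → Pattern m
cycleC m i j = pathP m i j
             ∨ ((toℕ i ≡ᵇ 0) ∧ (suc (toℕ j) ≡ᵇ m))
             ∨ ((toℕ j ≡ᵇ 0) ∧ (suc (toℕ i) ≡ᵇ m))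

fromEdges : (k : ℕ) → List (ℕ × ℕ) → Pattern k
fromEdges k es i j = any (λ { (a , b) → ((toℕ i ≡ᵇ a) ∧ (toℕ j ≡ᵇ b))
                                     ∨ ((toℕ i ≡ᵇ b) ∧ (toℕ j ≡ᵇ a)) }) es

-- S_{1,2,5}: center 0; legs 0-1 ; 0-2-3 ; 0-4-5-6-7-8.
S125 : Pattern 9
S125 = fromEdges 9 ((0 , 1) ∷ (0 , 2) ∷ (2 , 3) ∷ (0 , 4) ∷ (4 , 5) ∷ (5 , 6)
                    ∷ (6 , 7) ∷ (7 , 8) ∷ [])

-- S_{3,3,3}: center 0; legs 0-1-2-3 ; 0-4-5-6 ; 0-7-8-9.
S333 : Pattern 10
S333 = fromEdges 10 ((0 , 1) ∷ (1 , 2) ∷ (2 , 3) ∷ (0 , 4) ∷ (4 , 5) ∷ (5 , 6)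
                     ∷ (0 , 7) ∷ (7 , 8) ∷ (8 , 9) ∷ [])

Bipartite : Graph → Set
Bipartite G = Σ (V G → Bool) (λ c → ∀ (x y : V G) → adj G x y ≡ true → c x ≢ c y)

ChordalBipartite : Graph → Set
ChordalBipartite G = Bipartite G × (∀ k → 3 ≤ k → Free (cycleC (2 * k)) G)

InClosedNbhd : (G : Graph) → V G → V G → Set
InClosedNbhd G w x = (x ≡ w) ⊎ (adj G w x ≡ true)

EfficientDominating : (G : Graph) → (V G → Bool) → Set
EfficientDominating G D =
  ∀ (w : V G) → ∃[ x ] ((InClosedNbhd G w x × D x ≡ true)
                        × (∀ y → InClosedNbhd G w y → D y ≡ true → y ≡ x))

MidpointOfInducedP5 : (G : Graph) → V G → Set
MidpointOfInducedP5 G x =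
  ∃[ f ] (InducedCopy (pathP 5) G f × f (fromℕ< {2} (s≤s (s≤s (s≤s z≤n)))) ≡ x)

-- Let x ∈ D dominate u₂ and suppose v₁ ∉ D, so some z ∈ D dominates v₁.
-- Bipartiteness makes x and z nonadjacent to the path vertices of the wrong
-- colour, and since neither may be the midpoint of an induced P₅, x sees only
-- u₂ and z sees only v₁ on v₁u₂…v₄; as D is independent, x and z are
-- nonadjacent, so u₂ is the centre of an induced S_{1,2,5} with legs x,
-- v₁z and u₃…v₄.  Hence v₁ ∈ D, and u₄ ∈ D by reversing the path; the
-- interior vertices u₂,v₂,u₃,v₃ are midpoints of induced P₅'s, and u₁, v₄ are
-- adjacent to D.
module Submission where

open import Defs renaming (sym to adj-sym)
open import Data.Nat using (suc; _≡ᵇ_)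
open import Data.Fin using (Fin; toℕ; zero; suc; #_; opposite)
open import Data.Fin.Properties using (all?; any?) renaming (_≟_ to _≟ᶠ_)
open import Data.Bool using (Bool; true; false; _∨_; not; _xor_)
open import Data.Bool.Properties
  using (¬-not; not-involutive; not-distribˡ-xor; not-distribʳ-xor) renaming (_≟_ to _≟ᵇ_)
import Data.List as List
open import Data.Vec.Functional using ([]; _∷_)
open import Data.Product using (Σ; _×_; _,_; ∃)
open import Data.Sum using (_⊎_; inj₁; inj₂)
open import Data.Empty using (⊥-elim)
open import Function using (_∘_; case_of_)
open import Function.Definitions using (Injective)
open import Relation.Binary.PropositionalEquality
  using (_≡_; _≢_; refl; sym; trans; cong; module ≡-Reasoning)
open import Relation.Nullary using (¬_; Dec)
open import Relation.Nullary.Decidable using (True; toWitness; _⊎-dec_; ¬?)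

PreservesAdjacency : ∀ {k} → Pattern k → (G : Graph) → (Fin k → V G) → Set
PreservesAdjacency H G g = ∀ i j → H i j ≡ adj G (g i) (g j)

samePattern? : ∀ {k} (H H′ : Pattern k) → Dec (∀ i j → H i j ≡ H′ i j)
samePattern? H H′ = all? λ i → all? λ j → H i j ≟ᵇ H′ i j

TwinFree : ∀ {k} → Pattern k → Set
TwinFree H = ∀ i j → i ≡ j ⊎ ∃ λ l → H i l ≢ H j l

twinFree? : ∀ {k} (H : Pattern k) → Dec (TwinFree H)
twinFree? H = all? λ i → all? λ j → (i ≟ᶠ j) ⊎-dec any? λ l → ¬? (H i l ≟ᵇ H j l)

extend : ∀ {k} → Pattern k → (Fin k → Bool) → Pattern (suc k)
extend H a zero    zero    = false
extend H a zero    (suc j) = a j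
extend H a (suc i) zero    = a i
extend H a (suc i) (suc j) = H i j

twoK₂ : Pattern 4
twoK₂ = fromEdges 4 ((0 , 1) List.∷ (2 , 3) List.∷ List.[])

module InducedCopies (G : Graph) where

  twinFree⇒inducedCopy : ∀ {k} {H : Pattern k} {g : Fin k → V G}
    → TwinFree H → PreservesAdjacency H G g → InducedCopy H G g
  twinFree⇒inducedCopy {g = g} twinFree pg = injective , pg
    where
    injective : Injective _≡_ _≡_ g
    injective {i} {j} gi≡gj with twinFree i j
    ... | inj₁ i≡j = i≡j
    ... | inj₂ (l , differ) =
      ⊥-elim (differ (trans (pg i l) (trans (cong (λ v → adj G v (g l)) gi≡gj) (sym (pg j l)))))

  relabel : ∀ {k m} {H : Pattern k} {H′ : Pattern m} {g : Fin k → V G} (σ : Fin m → Fin k)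
    → PreservesAdjacency H G g → (∀ i j → H′ i j ≡ H (σ i) (σ j))
    → PreservesAdjacency H′ G (g ∘ σ)
  relabel σ pg H′≡H i j = trans (H′≡H i j) (pg (σ i) (σ j))

  preservesAdjacency-extend : ∀ {k} {H : Pattern k} {g : Fin k → V G} {a : Fin k → Bool} {v : V G}
    → PreservesAdjacency H G g → (∀ i → adj G v (g i) ≡ a i)
    → PreservesAdjacency (extend H a) G (v ∷ g)
  preservesAdjacency-extend {v = v} pg nv zero    zero    = sym (irrefl G v)
  preservesAdjacency-extend         pg nv zero    (suc j) = sym (nv j)
  preservesAdjacency-extend {g = g} pg nv (suc i) zero    = sym (trans (adj-sym G (g i) _) (nv i))
  preservesAdjacency-extend         pg nv (suc i) (suc j) = pg i j

  bridge-midpoint : ∀ {g : Fin 4 → V G} {m : V G} → PreservesAdjacency twoK₂ G g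
    → adj G m (g (# 0)) ≡ false → adj G m (g (# 1)) ≡ true
    → adj G m (g (# 2)) ≡ true → adj G m (g (# 3)) ≡ false
    → MidpointOfInducedP5 G m
  bridge-midpoint {g} {m} pg m≁g₀ m~g₁ m~g₂ m≁g₃ =
    _ , twinFree⇒inducedCopy (toWitness {a? = twinFree? (pathP 5)} _) path , refl
    where
    m-nbrs : ∀ i → adj G m (g i) ≡ (false ∷ true ∷ true ∷ false ∷ []) i
    m-nbrs zero                   = m≁g₀
    m-nbrs (suc zero)             = m~g₁
    m-nbrs (suc (suc zero))       = m~g₂
    m-nbrs (suc (suc (suc zero))) = m≁g₃
    path = relabel (# 1 ∷ # 2 ∷ # 0 ∷ # 3 ∷ # 4 ∷ [])
      (preservesAdjacency-extend pg m-nbrs) (toWitness {a? = samePattern? _ _} _)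

  pendants⇒S125 : ∀ {g : Fin 7 → V G} {x z : V G} → PreservesAdjacency (pathP 7) G g
    → (∀ i → adj G z (g i) ≡ (toℕ i ≡ᵇ 0)) → (∀ i → adj G x (g i) ≡ (toℕ i ≡ᵇ 1))
    → adj G x z ≡ false → HasInduced S125 G
  pendants⇒S125 pg z-nbrs x-nbrs x≁z =
    _ , twinFree⇒inducedCopy (toWitness {a? = twinFree? S125} _) spider
    where
    -- centre g₁, legs x, g₀z and g₂…g₆
    spider = relabel (# 3 ∷ # 0 ∷ # 2 ∷ # 1 ∷ # 4 ∷ # 5 ∷ # 6 ∷ # 7 ∷ # 8 ∷ [])
      (preservesAdjacency-extend {a = false ∷ λ i → toℕ i ≡ᵇ 1}
        (preservesAdjacency-extend pg z-nbrs) λ { zero → x≁z ; (suc i) → x-nbrs i })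
      (toWitness {a? = samePattern? _ _} _)

module EfficientDomination {G : Graph} {D : V G → Bool} (efficient : EfficientDominating G D) where

  independent : ∀ {a b} → D a ≡ true → D b ≡ true → adj G a b ≡ false
  independent {a} {b} a∈D b∈D = ¬-not a≁b
    where
    a≁b : adj G a b ≢ true
    a≁b a~b with efficient a
    ... | _ , _ , unique with trans (unique a (inj₁ refl) a∈D) (sym (unique b (inj₂ a~b) b∈D))
    ... | refl = case trans (sym a~b) (irrefl G a) of λ ()

  neighbour-of-D∉D : ∀ {a b} → D a ≡ true → adj G a b ≡ true → D b ≡ false
  neighbour-of-D∉D a∈D a~b = ¬-not λ b∈D → case trans (sym a~b) (independent a∈D b∈D) of λ ()

  dominating-neighbour : ∀ w → D w ≡ false → ∃ λ x → adj G x w ≡ true × D x ≡ true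
  dominating-neighbour w w∉D with efficient w
  ... | x , (inj₁ refl , x∈D) , _ with () ← trans (sym x∈D) w∉D
  ... | x , (inj₂ w~x , x∈D) , _ = x , trans (adj-sym G x w) w~x , x∈D

module Bipartition {G : Graph} (bipartite : Bipartite G) where

  open Σ bipartite renaming (proj₁ to c; proj₂ to proper)

  odd : ∀ {n} → Fin n → Bool
  odd zero    = false
  odd (suc i) = not (odd i)

  adjacent⇒colour-flips : ∀ {x y} → adj G x y ≡ true → c y ≡ not (c x)
  adjacent⇒colour-flips {x} {y} x~y = ¬-not λ cy≡cx → proper x y x~y (sym cy≡cx)

  sameColour⇒nonadjacent : ∀ {x y} → c x ≡ c y → adj G x y ≡ false
  sameColour⇒nonadjacent {x} {y} cx≡cy = ¬-not λ x~y → proper x y x~y cx≡cy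

  path-colour : ∀ {k} {g : Fin (suc k) → V G} → PreservesAdjacency (pathP (suc k)) G g
    → ∀ i → c (g i) ≡ odd i xor c (g zero)
  path-colour pg zero = refl
  path-colour {suc k} {g} pg (suc i) = begin
    c (g (suc i))                  ≡⟨ path-colour (λ a b → pg (suc a) (suc b)) i ⟩
    odd i xor c (g (suc zero))     ≡⟨ cong (odd i xor_) (adjacent⇒colour-flips g₀~g₁) ⟩
    odd i xor not (c (g zero))     ≡⟨ sym (not-distribʳ-xor (odd i) _) ⟩
    not (odd i xor c (g zero))     ≡⟨ not-distribˡ-xor (odd i) _ ⟩
    not (odd i) xor c (g zero)     ∎
    where
    open ≡-Reasoning
    g₀~g₁ : adj G (g zero) (g (suc zero)) ≡ true
    g₀~g₁ = sym (pg zero (suc zero))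

  oppositeParity⇒nonadjacent : ∀ {k} {g : Fin (suc k) → V G} {u} {i j}
    → PreservesAdjacency (pathP (suc k)) G g → adj G u (g i) ≡ true → odd j ≡ not (odd i)
    → adj G u (g j) ≡ false
  oppositeParity⇒nonadjacent {g = g} {u} {i} {j} pg u~gi parity =
    sameColour⇒nonadjacent (sym cgj≡cu)
    where
    open ≡-Reasoning
    cgj≡cu : c (g j) ≡ c u
    cgj≡cu = begin
      c (g j)                      ≡⟨ path-colour pg j ⟩
      odd j xor c (g zero)         ≡⟨ cong (_xor c (g zero)) parity ⟩
      not (odd i) xor c (g zero)   ≡⟨ sym (not-distribˡ-xor (odd i) _) ⟩
      not (odd i xor c (g zero))   ≡⟨ cong not (sym (path-colour pg i)) ⟩
      not (c (g i))                ≡⟨ cong not (adjacent⇒colour-flips u~gi) ⟩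
      not (not (c u))              ≡⟨ not-involutive (c u) ⟩
      c u                          ∎

module InducedP8 {G : Graph} (bipartite : Bipartite G) {D : V G → Bool}
  (efficient : EfficientDominating G D) (noMidpoint : ∀ x → D x ≡ true → ¬ MidpointOfInducedP5 G x)
  (S125-free : Free S125 G) (f : Fin 8 → V G) (pf : PreservesAdjacency (pathP 8) G f) where

  open InducedCopies G
  open EfficientDomination {G} {D} efficient
  open Bipartition {G} bipartite

  adj-path : ∀ i j → adj G (f i) (f j) ≡ pathP 8 i j
  adj-path i j = sym (pf i j)

  InducedTwoK₂ : (p q r s : Fin 8) → Set
  InducedTwoK₂ p q r s = True (samePattern? twoK₂ λ i j → pathP 8 (τ i) (τ j))
    where τ = p ∷ q ∷ r ∷ s ∷ []

  bridge : ∀ (p q r s : Fin 8) {m} {_ : InducedTwoK₂ p q r s}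
    → adj G m (f p) ≡ false → adj G m (f q) ≡ true
    → adj G m (f r) ≡ true → adj G m (f s) ≡ false
    → MidpointOfInducedP5 G m
  bridge p q r s {_} {induced} =
    bridge-midpoint (relabel (p ∷ q ∷ r ∷ s ∷ []) pf (toWitness induced))

  midpoint⇒∉D : ∀ {x} → MidpointOfInducedP5 G x → D x ≡ false
  midpoint⇒∉D {x} mid = ¬-not λ x∈D → noMidpoint x x∈D mid

  bridge-closed : ∀ (p q r s : Fin 8) {m} {_ : InducedTwoK₂ p q r s}
    → D m ≡ true → adj G m (f p) ≡ false → adj G m (f q) ≡ true → adj G m (f s) ≡ false
    → adj G m (f r) ≡ false
  bridge-closed p q r s {m} {induced} m∈D m≁p m~q m≁s =
    ¬-not λ m~r → noMidpoint m m∈D (bridge p q r s {_} {induced} m≁p m~q m~r m≁s)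

  u₂-dominator-neighbourhood : ∀ {x} → D x ≡ true → adj G x (f (# 2)) ≡ true
    → ∀ i → adj G x (f (suc i)) ≡ (toℕ i ≡ᵇ 1)
  u₂-dominator-neighbourhood {x} x∈D x~u₂ = neighbourhood
    where
    x≁odd : ∀ {j} → odd j ≡ true → adj G x (f j) ≡ false
    x≁odd = oppositeParity⇒nonadjacent pf x~u₂
    x≁u₃ : adj G x (f (# 4)) ≡ false
    x≁u₃ = bridge-closed (# 1) (# 2) (# 4) (# 5) x∈D (x≁odd refl) x~u₂ (x≁odd refl)
    x≁u₄ : adj G x (f (# 6)) ≡ false
    x≁u₄ = bridge-closed (# 1) (# 2) (# 6) (# 7) x∈D (x≁odd refl) x~u₂ (x≁odd refl)
    neighbourhood : ∀ i → adj G x (f (suc i)) ≡ (toℕ i ≡ᵇ 1)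
    neighbourhood zero                                      = x≁odd refl
    neighbourhood (suc zero)                                = x~u₂
    neighbourhood (suc (suc zero))                          = x≁odd refl
    neighbourhood (suc (suc (suc zero)))                    = x≁u₃
    neighbourhood (suc (suc (suc (suc zero))))              = x≁odd refl
    neighbourhood (suc (suc (suc (suc (suc zero)))))        = x≁u₄
    neighbourhood (suc (suc (suc (suc (suc (suc zero)))))) = x≁odd refl

  v₁-dominator-neighbourhood : ∀ {z} → D z ≡ true → adj G z (f (# 1)) ≡ true
    → ∀ i → adj G z (f (suc i)) ≡ (toℕ i ≡ᵇ 0)
  v₁-dominator-neighbourhood {z} z∈D z~v₁ = neighbourhood
    where
    z≁even : ∀ {j} → odd j ≡ false → adj G z (f j) ≡ false
    z≁even = oppositeParity⇒nonadjacent pf z~v₁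
    z≁v₂ : adj G z (f (# 3)) ≡ false
    z≁v₂ = bridge-closed (# 0) (# 1) (# 3) (# 4) z∈D (z≁even refl) z~v₁ (z≁even refl)
    z≁v₃ : adj G z (f (# 5)) ≡ false
    z≁v₃ = bridge-closed (# 0) (# 1) (# 5) (# 6) z∈D (z≁even refl) z~v₁ (z≁even refl)
    z≁v₄ : adj G z (f (# 7)) ≡ false
    z≁v₄ = bridge-closed (# 2) (# 1) (# 7) (# 6) z∈D (z≁even refl) z~v₁ (z≁even refl)
    neighbourhood : ∀ i → adj G z (f (suc i)) ≡ (toℕ i ≡ᵇ 0)
    neighbourhood zero                                      = z~v₁
    neighbourhood (suc zero)                                = z≁even refl
    neighbourhood (suc (suc zero))                          = z≁v₂
    neighbourhood (suc (suc (suc zero)))                    = z≁even refl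
    neighbourhood (suc (suc (suc (suc zero))))              = z≁v₃
    neighbourhood (suc (suc (suc (suc (suc zero)))))        = z≁even refl
    neighbourhood (suc (suc (suc (suc (suc (suc zero)))))) = z≁v₄

  u₂∉D : D (f (# 2)) ≡ false
  u₂∉D = midpoint⇒∉D
    (bridge (# 0) (# 1) (# 3) (# 4) (adj-path _ _) (adj-path _ _) (adj-path _ _) (adj-path _ _))

  v₁∈D : D (f (# 1)) ≡ true
  v₁∈D = ¬-not λ v₁∉D →
    let x , x~u₂ , x∈D = dominating-neighbour _ u₂∉D
        z , z~v₁ , z∈D = dominating-neighbour _ v₁∉D
    in S125-free (pendants⇒S125 (λ i j → pf (suc i) (suc j))
                   (v₁-dominator-neighbourhood z∈D z~v₁) (u₂-dominator-neighbourhood x∈D x~u₂)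
                   (independent x∈D z∈D))

lemma9 : (G : Graph) → Free S125 G → Free S333 G → ChordalBipartite G
    → (D : V G → Bool) → EfficientDominating G D
    → (∀ x → D x ≡ true → ¬ MidpointOfInducedP5 G x)
    → (f : Fin 8 → V G) → InducedCopy (pathP 8) G f
    → ∀ (i : Fin 8) → D (f i) ≡ ((toℕ i ≡ᵇ 1) ∨ (toℕ i ≡ᵇ 6))
lemma9 G S125-free _ (bipartite , _) D efficient noMidpoint f (_ , pf) = onPath
  where
  open InducedCopies G
  open EfficientDomination {G} {D} efficient
  module P8 = InducedP8 {G} bipartite {D} efficient noMidpoint S125-free
  open P8 f pf

  u₄∈D : D (f (# 6)) ≡ true
  u₄∈D = P8.v₁∈D (f ∘ opposite) (relabel opposite pf (toWitness {a? = samePattern? _ _} _))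

  onPath : ∀ (i : Fin 8) → D (f i) ≡ ((toℕ i ≡ᵇ 1) ∨ (toℕ i ≡ᵇ 6))
  onPath zero = neighbour-of-D∉D v₁∈D (adj-path (# 1) (# 0))
  onPath (suc zero) = v₁∈D
  onPath (suc (suc zero)) = u₂∉D
  onPath (suc (suc (suc zero))) =
    midpoint⇒∉D (bridge (# 1) (# 2) (# 4) (# 5) (adj-path _ _) (adj-path _ _) (adj-path _ _) (adj-path _ _))
  onPath (suc (suc (suc (suc zero)))) =
    midpoint⇒∉D (bridge (# 2) (# 3) (# 5) (# 6) (adj-path _ _) (adj-path _ _) (adj-path _ _) (adj-path _ _))
  onPath (suc (suc (suc (suc (suc zero))))) =
    midpoint⇒∉D (bridge (# 3) (# 4) (# 6) (# 7) (adj-path _ _) (adj-path _ _) (adj-path _ _) (adj-path _ _))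
  onPath (suc (suc (suc (suc (suc (suc zero)))))) = u₄∈D
  onPath (suc (suc (suc (suc (suc (suc (suc zero))))))) = neighbour-of-D∉D u₄∈D (adj-path (# 6) (# 7))
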